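{- Let $\mathcal L$ be a cubic algebra, and regard $\mathcal L$ as a subset of its enveloping algebra $\operatorname{env}(\mathcal L)$ via the embedding $e$. Then for $a,b\in\mathcal L$: $a\sim b$ in $\mathcal L$ if and only if $a\sim b$ in $\operatorname{env}(\mathcal L)$. Furthermore, if $a\in\mathcal L$, $b\in\operatorname{env}(\mathcal L)$ and $a\sim b$ in $\operatorname{env}(\mathcal L)$, then $b\in\mathcal L$.
   Context: A cubic algebra is a join-semilattice $\mathcal L$ with top $\mathbf 1$ and a binary operation $\Delta$ such that: if $x\le y$ then $\Delta(y,x)\vee x=y$; if $x\le y\le z$ then $\Delta(z,\Delta(y,x))=\Delta(\Delta(z,y),\Delta(z,x))$; if $x\le y$ then $\Delta(y,\Delta(y,x))=x$; if $x\le y\le z$ then $\Delta(z,x)\le\Delta(z,y)$; and with $xy:=\Delta(\mathbf 1,\Delta(x\vee y,y))\vee y$ one has $(xy)y=x\vee y$ and $x(yz)=y(xz)$. Cubic homomorphisms preserve $\vee$, $\mathbf 1$ and $\Delta$. An MR-algebra is a cubic algebra such that whenever $a,b<x$: $\Delta(x,a)\vee b<x$ iff $a\wedge b$ does not exist. In a cubic algebra, $a\sim b$ iff $\Delta(a\vee b,a)=b$. The enveloping algebra of a cubic algebra $\mathcal L$ is an MR-algebra $\operatorname{env}(\mathcal L)$ together with an embedding $e\colon\mathcal L\to\operatorname{env}(\mathcal L)$ such that the range of $e$ generates $\operatorname{env}(\mathcal L)$, the range of $e$ is an upwards-closed subalgebra, and every cubic homomorphism from $\mathcal L$ into an MR-algebra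 $\mathcal N$ lifts uniquely to a cubic homomorphism $\operatorname{env}(\mathcal L)\to\mathcal N$. -}

module Defs where

open import Level using (0ℓ)
open import Data.Product using (Σ; _×_; _,_)
open import Relation.Nullary using (¬_)
open import Relation.Binary.PropositionalEquality using (_≡_)

record CubicAlgebra : Set₁ where
  infixl 6 _∨_
  infix 4 _≤_ _<_
  field
    Carrier : Set
    _∨_ : Carrier → Carrier → Carrier
    𝟏 : Carrier
    Δ : Carrier → Carrier → Carrier
    ∨-assoc : ∀ x y z → (x ∨ y) ∨ z ≡ x ∨ (y ∨ z)
    ∨-comm  : ∀ x y → x ∨ y ≡ y ∨ x
    ∨-idem  : ∀ x → x ∨ x ≡ x
    ∨-top   : ∀ x → x ∨ 𝟏 ≡ 𝟏

  _≤_ : Carrier → Carrier → Set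
  x ≤ y = x ∨ y ≡ y

  _<_ : Carrier → Carrier → Set
  x < y = (x ≤ y) × ¬ (x ≡ y)

  _·_ : Carrier → Carrier → Carrier
  x · y = Δ 𝟏 (Δ (x ∨ y) y) ∨ y

  field
    ax1 : ∀ x y → x ≤ y → Δ y x ∨ x ≡ y
    ax2 : ∀ x y z → x ≤ y → y ≤ z → Δ z (Δ y x) ≡ Δ (Δ z y) (Δ z x)
    ax3 : ∀ x y → x ≤ y → Δ y (Δ y x) ≡ x
    ax4 : ∀ x y z → x ≤ y → y ≤ z → Δ z x ≤ Δ z y
    ax5 : ∀ x y → (x · y) · y ≡ x ∨ y
    ax6 : ∀ x y z → x · (y · z) ≡ y · (x · z)

  MeetExists : Carrier → Carrier → Set
  MeetExists a b = Σ Carrier λ c → (c ≤ a) × (c ≤ b) ×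
                     (∀ d → d ≤ a → d ≤ b → d ≤ c)

  _∼_ : Carrier → Carrier → Set
  a ∼ b = Δ (a ∨ b) a ≡ b

IsMR : CubicAlgebra → Set
IsMR L = ∀ a b x → a < x → b < x →
           ((Δ x a ∨ b < x → ¬ MeetExists a b) × (¬ MeetExists a b → Δ x a ∨ b < x))
  where open CubicAlgebra L

record MRAlgebra : Set₁ where
  field
    cubic : CubicAlgebra
    isMR  : IsMR cubic
  open CubicAlgebra cubic public

record IsCubicHom (L M : CubicAlgebra) (f : CubicAlgebra.Carrier L → CubicAlgebra.Carrier M) : Set where
  private
    module L = CubicAlgebra L
    module M = CubicAlgebra M
  field
    pres-∨ : ∀ x y → f (x L.∨ y) ≡ f x M.∨ f y
    pres-𝟏 : f L.𝟏 ≡ M.𝟏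
    pres-Δ : ∀ x y → f (L.Δ x y) ≡ M.Δ (f x) (f y)

data Generated (M : CubicAlgebra) (P : CubicAlgebra.Carrier M → Set) : CubicAlgebra.Carrier M → Set where
  gen-base : ∀ {x} → P x → Generated M P x
  gen-𝟏    : Generated M P (CubicAlgebra.𝟏 M)
  gen-∨    : ∀ {x y} → Generated M P x → Generated M P y → Generated M P (CubicAlgebra._∨_ M x y)
  gen-Δ    : ∀ {x y} → Generated M P x → Generated M P y → Generated M P (CubicAlgebra.Δ M x y)

record Envelope (L : CubicAlgebra) : Set₁ where
  field
    env   : MRAlgebra
  private
    module L = CubicAlgebra L
    module E = MRAlgebra env
  field
    e       : L.Carrier → E.Carrier
    e-hom   : IsCubicHom L E.cubic e
    e-inj   : ∀ x y → e x ≡ e y → x ≡ y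
  InRange : E.Carrier → Set
  InRange m = Σ L.Carrier λ x → e x ≡ m
  field
    generates : ∀ m → Generated E.cubic InRange m
    upClosed  : ∀ x m → e x E.≤ m → InRange m
    universal : (N : MRAlgebra) (f : L.Carrier → MRAlgebra.Carrier N) →
                IsCubicHom L (MRAlgebra.cubic N) f →
                Σ (E.Carrier → MRAlgebra.Carrier N) λ g →
                  IsCubicHom E.cubic (MRAlgebra.cubic N) g × (∀ x → g (e x) ≡ f x)
    uniqueness : (N : MRAlgebra) (f : L.Carrier → MRAlgebra.Carrier N) →
                 (g g′ : E.Carrier → MRAlgebra.Carrier N) →
                 IsCubicHom E.cubic (MRAlgebra.cubic N) g → (∀ x → g (e x) ≡ f x) →
                 IsCubicHom E.cubic (MRAlgebra.cubic N) g′ → (∀ x → g′ (e x) ≡ f x) →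
                 ∀ m → g m ≡ g′ m

module Submission where

-- Every cubic homomorphism f carries the term Δ(a ∨ b, a) to
-- Δ(f a ∨ f b, f a), since it preserves ∨ and Δ.  Hence f preserves ∼,
-- and if f is injective it also reflects ∼.  For the closure statement let
-- e a ∼ b in env(L).  Then e a ≤ e a ∨ b, so by upward closure of the range
-- e a ∨ b = e x for some x in L, and b = Δ(e x, e a) = e (Δ(x, a)).

open import Defs
open import Data.Product using (Σ; _×_; _,_)
open import Relation.Binary.PropositionalEquality using (_≡_; sym; trans; cong; module ≡-Reasoning)
open ≡-Reasoning

x≤x∨y : (L : CubicAlgebra) → let open CubicAlgebra L in ∀ x y → x ≤ x ∨ y
x≤x∨y L x y = begin
    x ∨ (x ∨ y)  ≡⟨ sym (∨-assoc x x y) ⟩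
    (x ∨ x) ∨ y  ≡⟨ cong (_∨ y) (∨-idem x) ⟩
    x ∨ y        ∎
  where open CubicAlgebra L

module _ {L M : CubicAlgebra} {f : CubicAlgebra.Carrier L → CubicAlgebra.Carrier M}
         (hom : IsCubicHom L M f) where
  private
    module L = CubicAlgebra L
    module M = CubicAlgebra M
  open IsCubicHom hom

  hom-∼-term : ∀ a b → f (L.Δ (a L.∨ b) a) ≡ M.Δ (f a M.∨ f b) (f a)
  hom-∼-term a b = begin
    f (L.Δ (a L.∨ b) a)        ≡⟨ pres-Δ (a L.∨ b) a ⟩
    M.Δ (f (a L.∨ b)) (f a)    ≡⟨ cong (λ z → M.Δ z (f a)) (pres-∨ a b) ⟩
    M.Δ (f a M.∨ f b) (f a)    ∎

  hom-preserves-∼ : ∀ a b → a L.∼ b → f a M.∼ f b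
  hom-preserves-∼ a b a∼b = trans (sym (hom-∼-term a b)) (cong f a∼b)

  injective-hom-reflects-∼ : (∀ x y → f x ≡ f y → x ≡ y) →
                              ∀ a b → f a M.∼ f b → a L.∼ b
  injective-hom-reflects-∼ inj a b fa∼fb = inj _ _ (trans (hom-∼-term a b) fa∼fb)

module _ {L : CubicAlgebra} (En : Envelope L) where
  open Envelope En
  private
    module L = CubicAlgebra L
    module M = MRAlgebra env
  open IsCubicHom e-hom

  range-closed-under-∼ : ∀ a b → e a M.∼ b → InRange b
  range-closed-under-∼ a b ea∼b with upClosed a (e a M.∨ b) (x≤x∨y M.cubic (e a) b)
  ... | x , ex≡ea∨b = L.Δ x a , (begin
    e (L.Δ x a)            ≡⟨ pres-Δ x a ⟩
    M.Δ (e x) (e a)        ≡⟨ cong (λ z → M.Δ z (e a)) ex≡ea∨b ⟩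
    M.Δ (e a M.∨ b) (e a)  ≡⟨ ea∼b ⟩
    b                      ∎)

theorem2p6 : (L : CubicAlgebra) (E : Envelope L) →
    ((a b : CubicAlgebra.Carrier L) →
    (CubicAlgebra._∼_ L a b → MRAlgebra._∼_ (Envelope.env E) (Envelope.e E a) (Envelope.e E b)) ×
    (MRAlgebra._∼_ (Envelope.env E) (Envelope.e E a) (Envelope.e E b) → CubicAlgebra._∼_ L a b)) ×
    ((a : CubicAlgebra.Carrier L) (b : MRAlgebra.Carrier (Envelope.env E)) →
    MRAlgebra._∼_ (Envelope.env E) (Envelope.e E a) b →
    Σ (CubicAlgebra.Carrier L) λ c → Envelope.e E c ≡ b)
theorem2p6 L En =
    (λ a b → hom-preserves-∼ e-hom a b , injective-hom-reflects-∼ e-hom e-inj a b)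
  , range-closed-under-∼ En
  where open Envelope En
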